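{- Let $X$ be a regular connected graph with a set $S$ of marked vertices. If $S$ is a vertex cut, then $\widehat{M}_{u,v}=0$ for any vertices $u$ and $v$ lying in different components of $X\setminus S$, and consequently, for every time $t$, the vector $U^tD_t^Te_v$ is zero on all outgoing arcs of $u$.
   Context: $X$ is $k$-regular. Arcs are ordered pairs $(u,v)$ of adjacent vertices; the outgoing arcs of $u$ are those with tail $u$. $R$ is the arc-reversal matrix; $D_t$ is the tail incidence matrix ($(D_t)_{x,(u,v)}=1$ iff $x=u$); $O_S$ is the identity with $[S,S]$ block zeroed; $U=R\left(\frac2kD_t^TO_SD_t-I\right)$. The average vertex mixing matrix is $\widehat{M}_{u,v}=\lim_{T\to\infty}\frac1T\sum_{t=0}^{T-1}\sum_{w\sim u}|(U^tx_v)_{(u,w)}|^2$ with $x_v=k^{ -1/2}D_t^Te_v$. -}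

module Defs where

open import Data.Bool using (Bool; true; false; if_then_else_; _∧_; not)
open import Data.Nat as ℕ using (ℕ; zero; suc)
open import Data.Fin using (Fin; _≟_)
open import Data.Integer using (+_)
open import Data.List using (List; []; _∷_; map; concatMap; allFin; foldr; upTo)
open import Data.Product using (_×_; _,_; Σ)
open import Data.Rational using (ℚ; 0ℚ; 1ℚ; _+_; _*_; _-_; _/_; _<_; ∣_∣)
open import Relation.Nullary.Decidable using (⌊_⌋)
open import Relation.Nullary using (¬_)
open import Relation.Binary.PropositionalEquality using (_≡_)

record IsSimpleGraph {n : ℕ} (adj : Fin n → Fin n → Bool) : Set where
  field
    symmetric   : ∀ x y → adj x y ≡ adj y x
    irreflexive : ∀ x → adj x x ≡ false

degree : {n : ℕ} → (Fin n → Fin n → Bool) → Fin n → ℕ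
degree {n} adj x = foldr (λ y acc → if adj x y then suc acc else acc) 0 (allFin n)

IsRegular : {n : ℕ} → (Fin n → Fin n → Bool) → ℕ → Set
IsRegular adj k = ∀ x → degree adj x ≡ k

data Reach {n : ℕ} (adj : Fin n → Fin n → Bool) (allowed : Fin n → Bool)
           : Fin n → Fin n → Set where
  here  : ∀ {x} → allowed x ≡ true → Reach adj allowed x x
  there : ∀ {x y z} → allowed x ≡ true → adj x y ≡ true →
          Reach adj allowed y z → Reach adj allowed x z

IsConnected : {n : ℕ} → (Fin n → Fin n → Bool) → Set
IsConnected adj = ∀ x y → Reach adj (λ _ → true) x y

outside : {n : ℕ} → (Fin n → Bool) → Fin n → Bool
outside S x = not (S x)

DifferentComponents : {n : ℕ} → (Fin n → Fin n → Bool) → (Fin n → Bool) →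
                      Fin n → Fin n → Set
DifferentComponents adj S u v =
  (S u ≡ false) × (S v ≡ false) × ¬ Reach adj (outside S) u v

IsVertexCut : {n : ℕ} → (Fin n → Fin n → Bool) → (Fin n → Bool) → Set
IsVertexCut {n} adj S = Σ (Fin n) λ u → Σ (Fin n) λ v → DifferentComponents adj S u v

Mat : Set → Set → Set
Mat I J = I → J → ℚ

Vect : Set → Set
Vect I = I → ℚ

sumL : {A : Set} → List A → (A → ℚ) → ℚ
sumL xs f = foldr (λ x acc → f x + acc) 0ℚ xs

mmul : {I J K : Set} → List J → Mat I J → Mat J K → Mat I K
mmul js A B i k = sumL js (λ j → A i j * B j k)

mvec : {I J : Set} → List J → Mat I J → Vect J → Vect I
mvec js A x i = sumL js (λ j → A i j * x j)

transpose : {I J : Set} → Mat I J → Mat J I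
transpose A j i = A i j

msub : {I J : Set} → Mat I J → Mat I J → Mat I J
msub A B i j = A i j - B i j

mscale : {I J : Set} → ℚ → Mat I J → Mat I J
mscale c A i j = c * A i j

⟦_⟧ : Bool → ℚ
⟦ b ⟧ = if b then 1ℚ else 0ℚ

eqF : {n : ℕ} → Fin n → Fin n → Bool
eqF a b = ⌊ a ≟ b ⌋

-- Arcs are ordered pairs (u , v) with adj u v; matrices indexed by arcs are
-- represented as matrices on all ordered pairs that vanish off the arcs.
Pair : ℕ → Set
Pair n = Fin n × Fin n

allPairs : (n : ℕ) → List (Pair n)
allPairs n = concatMap (λ a → map (λ b → (a , b)) (allFin n)) (allFin n)

-- the scalars 2/k and 1/k (k = 0 never occurs for the graphs considered:
-- a connected graph with a vertex cut has at least 3 vertices, so k ≥ 1)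
twoOver : ℕ → ℚ
twoOver zero    = 0ℚ
twoOver (suc m) = + 2 / suc m

oneOver : ℕ → ℚ
oneOver zero    = 0ℚ
oneOver (suc m) = + 1 / suc m

module Walk {n : ℕ} (adj : Fin n → Fin n → Bool) (k : ℕ) (S : Fin n → Bool) where

  isArc : Pair n → Bool
  isArc (a , b) = adj a b

  Iarc : Mat (Pair n) (Pair n)
  Iarc (a , b) (c , d) = ⟦ eqF a c ∧ eqF b d ∧ adj a b ⟧

  R : Mat (Pair n) (Pair n)
  R (a , b) (c , d) = ⟦ eqF a d ∧ eqF b c ∧ adj a b ⟧

  Dt : Mat (Fin n) (Pair n)
  Dt x (u , v) = ⟦ eqF x u ∧ adj u v ⟧

  OS : Mat (Fin n) (Fin n)
  OS x y = ⟦ eqF x y ∧ not (S x) ⟧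

  twoOverK : ℚ
  twoOverK = twoOver k

  oneOverK : ℚ
  oneOverK = oneOver k

  U : Mat (Pair n) (Pair n)
  U = mmul (allPairs n) R
        (msub (mscale twoOverK
                 (mmul (allFin n) (transpose Dt) (mmul (allFin n) OS Dt)))
              Iarc)

  Upow : ℕ → Mat (Pair n) (Pair n)
  Upow zero    = Iarc
  Upow (suc t) = mmul (allPairs n) U (Upow t)

  e : Fin n → Vect (Fin n)
  e v x = ⟦ eqF x v ⟧

  walkVec : ℕ → Fin n → Vect (Pair n)
  walkVec t v = mvec (allPairs n) (Upow t) (mvec (allFin n) (transpose Dt) (e v))

  -- Σ_{w ~ u} |(U^t x_v)_{(u,w)}|^2  with  x_v = k^{-1/2} D_tᵀ e_v,
  -- computed as (1/k) Σ_{w ~ u} ((U^t D_tᵀ e_v)_{(u,w)})^2 (all entries real)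
  mixTerm : Fin n → Fin n → ℕ → ℚ
  mixTerm u v t = sumL (allFin n)
    (λ w → ⟦ adj u w ⟧ * (oneOverK * (walkVec t v (u , w) * walkVec t v (u , w))))

  -- Cesàro average (1/T) Σ_{t=0}^{T-1} mixTerm u v t, for T = suc T'
  cesaro : Fin n → Fin n → ℕ → ℚ
  cesaro u v T' = (+ 1 / suc T') * sumL (upTo (suc T')) (mixTerm u v)

ConvergesTo : (ℕ → ℚ) → ℚ → Set
ConvergesTo f L = ∀ ε → 0ℚ < ε → Σ ℕ λ N → ∀ T → N ℕ.≤ T → ∣ f T - L ∣ < ε

MhatIs : {n : ℕ} → (Fin n → Fin n → Bool) → ℕ → (Fin n → Bool) →
         Fin n → Fin n → ℚ → Set
MhatIs adj k S u v L = ConvergesTo (λ T' → Walk.cesaro adj k S u v T') L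

-- Let C be the component of v in X \ S and call an arc owned by C if its tail lies in C,
-- or its tail is marked and its head lies in C.  The coin (2/k) Dtᵀ O_S Dt − I only mixes
-- arcs with a common unmarked tail and acts as −I at marked tails, and R reverses arcs;
-- so U, hence every U^t, maps vectors supported on owned arcs to such vectors.  Dtᵀ e_v is
-- supported on the arcs leaving v, so U^t Dtᵀ e_v vanishes on every arc leaving u ∉ C ∪ S,
-- and every term of the Cesàro average defining M̂_{u,v} is 0.
module Submission where

open import Defs
open import Data.Bool using (Bool; true; false; not)
open import Data.Bool.Properties using (not-injective)
open import Data.Nat using (ℕ; zero; suc)
open import Data.Fin using (Fin) renaming (_≟_ to _≟F_)
open import Data.List using (List; []; _∷_; allFin; upTo)
open import Data.Product using (_×_; _,_)
open import Data.Sum using (_⊎_; inj₁; inj₂)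
open import Data.Empty using (⊥; ⊥-elim)
open import Data.Integer using (+_)
open import Data.Rational using (ℚ; 0ℚ; _+_; _*_; _-_; _/_; ∣_∣; _<_)
open import Data.Rational.Properties
  using (*-zeroˡ; *-zeroʳ; *-identityˡ; +-identityˡ; +-inverseʳ) renaming (_≟_ to _≟Q_)
open import Relation.Nullary using (¬_; yes; no)
open import Relation.Binary.PropositionalEquality
  using (_≡_; _≢_; refl; sym; trans; cong; cong₂; subst)

sumL-≡0 : {A : Set} (xs : List A) (f : A → ℚ) → (∀ x → f x ≡ 0ℚ) → sumL xs f ≡ 0ℚ
sumL-≡0 []       f f≡0 = refl
sumL-≡0 (x ∷ xs) f f≡0 = trans (cong₂ _+_ (f≡0 x) (sumL-≡0 xs f f≡0)) (+-identityˡ 0ℚ)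

*-≡0ʳ : (p q : ℚ) → (p ≢ 0ℚ → q ≡ 0ℚ) → p * q ≡ 0ℚ
*-≡0ʳ p q h with p ≟Q 0ℚ
... | yes p≡0 = trans (cong (_* q) p≡0) (*-zeroˡ q)
... | no  p≢0 = trans (cong (p *_) (h p≢0)) (*-zeroʳ p)

*-≡0ˡ : (p q : ℚ) → (q ≢ 0ℚ → p ≡ 0ℚ) → p * q ≡ 0ℚ
*-≡0ˡ p q h with q ≟Q 0ℚ
... | yes q≡0 = trans (cong (p *_) q≡0) (*-zeroʳ p)
... | no  q≢0 = trans (cong (_* q) (h q≢0)) (*-zeroˡ q)

⟦⟧-≡0 : (b : Bool) → b ≢ true → ⟦ b ⟧ ≡ 0ℚ
⟦⟧-≡0 false _ = refl
⟦⟧-≡0 true  h = ⊥-elim (h refl)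

⟦⟧*-≡0 : (b : Bool) {q : ℚ} → (b ≡ true → q ≡ 0ℚ) → ⟦ b ⟧ * q ≡ 0ℚ
⟦⟧*-≡0 false {q} _ = *-zeroˡ q
⟦⟧*-≡0 true  {q} h = trans (*-identityˡ q) (h refl)

convergesTo-const : (f : ℕ → ℚ) (L : ℚ) → (∀ T → f T ≡ L) → ConvergesTo f L
convergesTo-const f L f≡L ε 0<ε =
  0 , λ T _ → subst (λ q → ∣ q ∣ < ε)
                    (sym (trans (cong (_- L) (f≡L T)) (+-inverseʳ L))) 0<ε

module Support {I : Set} where

  VanishesOff : (I → Set) → Vect I → Set
  VanishesOff P x = ∀ {p} → ¬ P p → x p ≡ 0ℚ

  -- A maps vectors vanishing off P to vectors vanishing off Q.  The double negation
  -- lets entries be discarded by deciding whether they vanish, without deciding P.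
  Maps : (I → Set) → (I → Set) → Mat I I → Set
  Maps P Q A = ∀ {p q} → ¬ Q p → ¬ ¬ P q → A p q ≡ 0ℚ

  mmul-maps : (js : List I) {P Q R : I → Set} {A B : Mat I I} →
              Maps Q R A → Maps P Q B → Maps P R (mmul js A B)
  mmul-maps js {A = A} {B} A-maps B-maps {p} {q} ¬Rp ¬¬Pq = sumL-≡0 js _ λ r →
    *-≡0ʳ (A p r) (B r q) λ Apr≢0 → B-maps (λ Qr → Apr≢0 (A-maps ¬Rp λ ¬Qr → ¬Qr Qr)) ¬¬Pq

  mvec-vanishesOff : (js : List I) {P Q : I → Set} {A : Mat I I} {x : Vect I} →
                     Maps P Q A → VanishesOff P x → VanishesOff Q (mvec js A x)
  mvec-vanishesOff js {A = A} {x} A-maps x-vanishes {p} ¬Qp = sumL-≡0 js _ λ q →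
    *-≡0ˡ (A p q) (x q) λ xq≢0 → A-maps ¬Qp λ ¬Pq → xq≢0 (x-vanishes ¬Pq)

module Entries {n : ℕ} (adj : Fin n → Fin n → Bool) (k : ℕ) (S : Fin n → Bool) where
  open Walk adj k S

  Iarc-≡0 : ∀ x y c d → (x ≡ c → y ≡ d → adj x y ≡ true → ⊥) → Iarc (x , y) (c , d) ≡ 0ℚ
  Iarc-≡0 x y c d h with x ≟F c | y ≟F d
  ... | no _    | _       = refl
  ... | yes _   | no _    = refl
  ... | yes x≡c | yes y≡d = ⟦⟧-≡0 (adj x y) (h x≡c y≡d)

  R-≡0 : ∀ a b c d → (a ≡ d → b ≡ c → ⊥) → R (a , b) (c , d) ≡ 0ℚ
  R-≡0 a b c d h with a ≟F d | b ≟F c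
  ... | no _    | _       = refl
  ... | yes _   | no _    = refl
  ... | yes a≡d | yes b≡c = ⊥-elim (h a≡d b≡c)

  DtᵀOSDt-≡0 : ∀ x y c d → (x ≡ c → S x ≡ false → adj x y ≡ true → ⊥) →
               mmul (allFin n) (transpose Dt) (mmul (allFin n) OS Dt) (x , y) (c , d) ≡ 0ℚ
  DtᵀOSDt-≡0 x y c d h = sumL-≡0 (allFin n) _ summand
    where
    inner : adj x y ≡ true → ∀ w → OS x w * Dt w (c , d) ≡ 0ℚ
    inner xy w with x ≟F w
    ... | no _ = *-zeroˡ (Dt w (c , d))
    ... | yes refl with x ≟F c
    ...   | no _    = *-zeroʳ ⟦ not (S x) ⟧
    ...   | yes x≡c = ⟦⟧*-≡0 (not (S x)) λ ¬sx → ⊥-elim (h x≡c (not-injective ¬sx) xy)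
    summand : ∀ z → Dt z (x , y) * mmul (allFin n) OS Dt z (c , d) ≡ 0ℚ
    summand z with z ≟F x
    ... | no _     = *-zeroˡ (mmul (allFin n) OS Dt z (c , d))
    ... | yes refl = ⟦⟧*-≡0 (adj z y) λ zy → sumL-≡0 (allFin n) _ (inner zy)

  coin : Mat (Pair n) (Pair n)
  coin = msub (mscale twoOverK (mmul (allFin n) (transpose Dt) (mmul (allFin n) OS Dt))) Iarc

  coin-≡0 : ∀ x y c d → (x ≡ c → S x ≡ false → adj x y ≡ true → ⊥) →
            (x ≡ c → y ≡ d → adj x y ≡ true → ⊥) → coin (x , y) (c , d) ≡ 0ℚ
  coin-≡0 x y c d mixing-term identity-term =
    cong₂ _-_ (trans (cong (twoOverK *_) (DtᵀOSDt-≡0 x y c d mixing-term)) (*-zeroʳ twoOverK))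
              (Iarc-≡0 x y c d identity-term)

  Dtᵀe-≡0 : ∀ v a b → a ≢ v → mvec (allFin n) (transpose Dt) (e v) (a , b) ≡ 0ℚ
  Dtᵀe-≡0 v a b a≢v = sumL-≡0 (allFin n) _ summand
    where
    summand : ∀ x → Dt x (a , b) * e v x ≡ 0ℚ
    summand x with x ≟F a
    ... | no _     = *-zeroˡ (e v x)
    ... | yes refl with x ≟F v
    ...   | no _    = *-zeroʳ ⟦ adj x b ⟧
    ...   | yes x≡v = ⊥-elim (a≢v x≡v)

  cesaro-≡0 : ∀ u v → (∀ t w → walkVec t v (u , w) ≡ 0ℚ) → ∀ T → cesaro u v T ≡ 0ℚ
  cesaro-≡0 u v walk≡0 T =
    trans (cong ((+ 1 / suc T) *_) (sumL-≡0 (upTo (suc T)) (mixTerm u v) mixTerm≡0))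
          (*-zeroʳ (+ 1 / suc T))
    where
    mixTerm≡0 : ∀ t → mixTerm u v t ≡ 0ℚ
    mixTerm≡0 t = sumL-≡0 (allFin n) _ λ w → ⟦⟧*-≡0 (adj u w) λ _ →
      trans (cong (λ q → oneOverK * (q * q)) (walk≡0 t w)) (*-zeroʳ oneOverK)

module Confinement {n : ℕ} (adj : Fin n → Fin n → Bool) (k : ℕ) (S : Fin n → Bool)
                   (adj-sym : ∀ x y → adj x y ≡ adj y x) (v : Fin n) (Sv : S v ≡ false) where
  open Walk adj k S
  open Entries adj k S
  open Support

  InComponent : Fin n → Set
  InComponent a = Reach adj (outside S) a v

  OwnedArc : Pair n → Set
  OwnedArc (a , b) = InComponent a ⊎ (S a ≡ true × InComponent b)

  ReversedOwnedArc : Pair n → Set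
  ReversedOwnedArc (a , b) = OwnedArc (b , a)

  arc-into-component : ∀ {a b} → adj a b ≡ true → InComponent b → OwnedArc (a , b)
  arc-into-component {a} ab b∈C with S a in sa
  ... | true  = inj₂ (refl , b∈C)
  ... | false = inj₁ (there (cong not sa) ab b∈C)

  ownedArc-reverse : ∀ {a b} → adj b a ≡ true → OwnedArc (a , b) → OwnedArc (b , a)
  ownedArc-reverse ba (inj₁ a∈C)       = arc-into-component ba a∈C
  ownedArc-reverse ba (inj₂ (_ , b∈C)) = inj₁ b∈C

  unmarked-tail : ∀ {a b} → S a ≡ false → OwnedArc (a , b) → InComponent a
  unmarked-tail sa (inj₁ a∈C)      = a∈C
  unmarked-tail sa (inj₂ (sa′ , _)) with () ← trans (sym sa) sa′

  coin-maps : Maps OwnedArc ReversedOwnedArc coin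
  coin-maps {x , y} {c , d} ¬yx-owned ¬¬cd-owned = coin-≡0 x y c d
    (λ x≡c sx xy → ¬¬cd-owned λ cd-owned → ¬yx-owned
      (arc-into-component (reverse xy)
        (unmarked-tail sx (subst (λ z → OwnedArc (z , d)) (sym x≡c) cd-owned))))
    (λ x≡c y≡d xy → ¬¬cd-owned λ cd-owned → ¬yx-owned
      (ownedArc-reverse (reverse xy) (subst OwnedArc (sym (cong₂ _,_ x≡c y≡d)) cd-owned)))
    where
    reverse : adj x y ≡ true → adj y x ≡ true
    reverse = trans (adj-sym y x)

  R-maps : Maps ReversedOwnedArc OwnedArc R
  R-maps {a , b} {c , d} ¬ab-owned ¬¬dc-owned =
    R-≡0 a b c d λ { refl refl → ¬¬dc-owned ¬ab-owned }

  Iarc-maps : Maps OwnedArc OwnedArc Iarc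
  Iarc-maps {x , y} {c , d} ¬xy-owned ¬¬cd-owned = Iarc-≡0 x y c d λ x≡c y≡d _ →
    ¬¬cd-owned λ cd-owned → ¬xy-owned (subst OwnedArc (sym (cong₂ _,_ x≡c y≡d)) cd-owned)

  U-maps : Maps OwnedArc OwnedArc U
  U-maps = mmul-maps (allPairs n) {OwnedArc} {ReversedOwnedArc} {OwnedArc} R-maps coin-maps

  Upow-maps : ∀ t → Maps OwnedArc OwnedArc (Upow t)
  Upow-maps zero    = Iarc-maps
  Upow-maps (suc t) =
    mmul-maps (allPairs n) {OwnedArc} {OwnedArc} {OwnedArc} U-maps (Upow-maps t)

  Dtᵀe-vanishesOff : VanishesOff OwnedArc (mvec (allFin n) (transpose Dt) (e v))
  Dtᵀe-vanishesOff {a , b} ¬ab-owned =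
    Dtᵀe-≡0 v a b λ { refl → ¬ab-owned (inj₁ (here (cong not Sv))) }

  walkVec-vanishesOff : ∀ t → VanishesOff OwnedArc (walkVec t v)
  walkVec-vanishesOff t =
    mvec-vanishesOff (allPairs n) {OwnedArc} {OwnedArc} (Upow-maps t) Dtᵀe-vanishesOff

corollary4p4 : (n k : ℕ) (adj : Fin n → Fin n → Bool) (S : Fin n → Bool) →
    IsSimpleGraph adj → IsRegular adj k → IsConnected adj →
    IsVertexCut adj S →
    (u v : Fin n) → DifferentComponents adj S u v →
    MhatIs adj k S u v 0ℚ ×
    (∀ (t : ℕ) (w : Fin n) → adj u w ≡ true → Walk.walkVec adj k S t v (u , w) ≡ 0ℚ)
corollary4p4 n k adj S simple _ _ _ u v (Su , Sv , u↛v) =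
  convergesTo-const _ 0ℚ (Entries.cesaro-≡0 adj k S u v walk≡0) , λ t w _ → walk≡0 t w
  where
  open Confinement adj k S (IsSimpleGraph.symmetric simple) v Sv
  walk≡0 : ∀ t w → Walk.walkVec adj k S t v (u , w) ≡ 0ℚ
  walk≡0 t w = walkVec-vanishesOff t λ uw-owned → u↛v (unmarked-tail Su uw-owned)
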